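{- Let $1\le k<r$ and let $b_0,\dots,b_k\in\mathbb{N}$ be such that $\binom{r-i}{k-i}b_i\equiv0\bmod b_k$ for all $i\in\{0,\dots,k\}$. Let $V$ be a finite set and let $\phi:\binom{V}{r}\to\mathbb{Z}$ be a $(b_0,\dots,b_{k-1})$-divisible function. Suppose that there exists a subset $K\subseteq V$ of size $2k-1$ such that whenever $S\in\binom{V}{k}$ satisfies $\phi(S)\not\equiv0\bmod b_k$, then $S\subseteq K$. Then $\phi$ is $(b_0,\dots,b_k)$-divisible.
   Context: A function $\phi:\binom{V}{r}\to\mathbb{Z}$ is extended to all $S\subseteq V$ with $|S|\le r$ by $\phi(S):=\sum_{S'\in\binom{V}{r}:S\subseteq S'}\phi(S')$. For $j\le r-1$ and $b_0,\dots,b_j\in\mathbb{N}$, $\phi$ is $(b_0,\dots,b_j)$-divisible if $b_{|S|}$ divides $\phi(S)$ for all $S\subseteq V$ with $|S|\le j$. -}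

module Defs where

open import Data.Nat using (ℕ; zero; suc; _≤_; _≟_)
open import Data.Integer using (ℤ; 0ℤ; +_) renaming (_+_ to _+ℤ_)
open import Data.Integer.Divisibility using () renaming (_∣_ to _∣ℤ_)
open import Data.Fin.Subset using (Subset; ∣_∣; _⊆_; inside; outside)
open import Data.Fin.Subset.Properties using (_⊆?_)
open import Data.List using (List; []; _∷_; _++_; map; filter; foldr)
open import Data.Vec using (_∷_; [])
open import Relation.Nullary.Decidable using (_×-dec_)
open import Data.Product using (_×_)

allSubsets : (n : ℕ) → List (Subset n)
allSubsets zero = [] ∷ []
allSubsets (suc n) = map (outside ∷_) (allSubsets n) ++ map (inside ∷_) (allSubsets n)

rSupersets : {n : ℕ} (r : ℕ) (S : Subset n) → List (Subset n)
rSupersets {n} r S = filter (λ S' → (∣ S' ∣ ≟ r) ×-dec (S ⊆? S')) (allSubsets n)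

-- A function φ : (V choose r) → ℤ is modelled as φ : Subset n → ℤ whose
-- values on non-r-sets are never used.  Its extension to S (with |S| ≤ r):
-- φ(S) := Σ_{S' ∈ (V choose r), S ⊆ S'} φ(S').
ext : {n : ℕ} (r : ℕ) (φ : Subset n → ℤ) (S : Subset n) → ℤ
ext r φ S = foldr _+ℤ_ 0ℤ (map φ (rSupersets r S))

Divisible : {n : ℕ} (r : ℕ) (φ : Subset n → ℤ) (b : ℕ → ℕ) (j : ℕ) → Set
Divisible r φ b j = ∀ S → ∣ S ∣ ≤ j → (+ b ∣ S ∣) ∣ℤ ext r φ S

-- For |A| ≤ k, double counting the chains A ⊆ S ⊆ R with |S| = k and |R| = r gives
--   Σ_{S ⊇ A, |S| = k} φ(S) = C(r − |A|, k − |A|) · φ(A),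
-- so the hypothesis on b makes this sum divisible by b_k whenever |A| < k.  Inclusion–exclusion
-- over a list T of excluded vertices extends this to the sum over the k-sets S ⊇ A avoiding T,
-- as long as |A| + |T| < k.  If b_k ∤ φ(S₀) for a k-set S₀, then S₀ ⊆ K; take A = ∅ and
-- T = K ∖ S₀, of size k − 1.  Every other k-set avoiding T has φ-value divisible by b_k, since a
-- bad one would lie in K ∖ T = S₀.  Hence b_k ∣ φ(S₀) after all.

module Submission where

open import Defs
open import Data.Nat using (ℕ; suc; _≤_; _<_; _∸_; _*_; _+_)
open import Data.Nat.Divisibility using (_∣_)
open import Data.Nat.Combinatorics using (_C_)
open import Data.Integer using (ℤ; +_)
open import Data.Integer.Divisibility using () renaming (_∣_ to _∣ℤ_)
open import Data.Fin.Subset using (Subset; ∣_∣; _⊆_)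
open import Data.Product using (Σ; _×_)
open import Relation.Binary.PropositionalEquality using (_≡_)
open import Relation.Nullary using (¬_)

open import Data.Nat using (zero; z≤n; s≤s; _≟_)
open import Data.Nat.Properties
  using (suc-injective; +-suc; +-comm; +-identityʳ; +-cancelʳ-≤; 1+n≰n; ≤-trans; ≤-reflexive
        ; m≤n⇒m<n∨m≡n; ≤-pred; +-monoʳ-≤; +-monoˡ-≤; n≤1+n; m+[n∸m]≡n; +-∸-assoc)
open import Data.Nat.Combinatorics using (nCk+nC[k+1]≡[n+1]C[k+1])
open import Data.Integer using (0ℤ; 1ℤ) renaming (_+_ to _+ℤ_; _*_ to _*ℤ_)
import Data.Integer.Properties as ℤ
open import Data.Integer.Divisibility.Signed
  using (divides; ∣ᵤ⇒∣; ∣⇒∣ᵤ; ∣-trans; ∣m∣n⇒∣m+n; ∣m+n∣n⇒∣m; ∣m+n∣m⇒∣n; *-monoʳ-∣)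
  renaming (_∣_ to _∣ˢ_; _∣?_ to _∣ˢ?_)
open import Algebra.Properties.CommutativeSemigroup ℤ.+-commutativeSemigroup using (interchange)
open import Data.Fin as Fin using (Fin)
open import Data.Fin.Subset
  using (Side; inside; outside; _∈_; _∉_; _∪_; _─_; ⁅_⁆) renaming (⊥ to ∅)
open import Data.Fin.Subset.Properties
  using (_⊆?_; _∈?_; ⊥⊆; drop-∷-⊆; out⊆; s⊆s; p⊆q⇒∣p∣≤∣q∣; ∣p∣≤∣x∷p∣
        ; ∣⊥∣≡0; ∣⁅x⁆∣≡1; p⊆p∪q; q⊆p∪q; x∈⁅x⁆; x∈p∪q⁻; x∈⁅y⁆⇒x≡y; x∈p∧x∉q⇒x∈p─q)
open import Data.Vec using (_∷_; []; here; there; tail)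
open import Data.List using (List; []; _∷_; _++_; map; filter; foldr; length)
open import Data.List.Properties using (length-map)
open import Data.List.Relation.Unary.All using (All; []; _∷_; all?)
open import Data.List.Relation.Unary.All.Properties using (map⁺; map⁻)
open import Data.Product using (_,_; proj₁)
open import Data.Sum using (inj₁; inj₂)
open import Data.Empty using (⊥-elim)
open import Function using (_∘_)
open import Relation.Binary.PropositionalEquality
  using (_≢_; refl; sym; trans; cong; cong₂; subst; module ≡-Reasoning)
open import Relation.Nullary using (Dec; yes; no)
open import Relation.Nullary.Decidable using (_×-dec_; ¬?)

private
  variable
    A B : Set
    P Q : Set
    n : ℕ

∑ : List A → (A → ℤ) → ℤ
∑ xs f = foldr _+ℤ_ 0ℤ (map f xs)

infixr 8 [_]·_

[_]·_ : Dec P → ℤ → ℤ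
[ yes _ ]· v = v
[ no _ ]· _ = 0ℤ

module _ {f g : A → ℤ} where

  ∑-cong : (xs : List A) → (∀ x → f x ≡ g x) → ∑ xs f ≡ ∑ xs g
  ∑-cong [] _ = refl
  ∑-cong (x ∷ xs) f≡g = cong₂ _+ℤ_ (f≡g x) (∑-cong xs f≡g)

  ∑-+ : (xs : List A) → ∑ xs (λ x → f x +ℤ g x) ≡ ∑ xs f +ℤ ∑ xs g
  ∑-+ [] = refl
  ∑-+ (x ∷ xs) = trans (cong (f x +ℤ g x +ℤ_) (∑-+ xs)) (interchange (f x) (g x) _ _)

∑-zero : {f : A → ℤ} (xs : List A) → (∀ x → f x ≡ 0ℤ) → ∑ xs f ≡ 0ℤ
∑-zero [] _ = refl
∑-zero (x ∷ xs) f≡0 = cong₂ _+ℤ_ (f≡0 x) (∑-zero xs f≡0)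

∑-++ : (xs ys : List A) (f : A → ℤ) → ∑ (xs ++ ys) f ≡ ∑ xs f +ℤ ∑ ys f
∑-++ [] ys f = sym (ℤ.+-identityˡ _)
∑-++ (x ∷ xs) ys f = trans (cong (f x +ℤ_) (∑-++ xs ys f)) (sym (ℤ.+-assoc (f x) _ _))

∑-map : (g : A → B) (xs : List A) (f : B → ℤ) → ∑ (map g xs) f ≡ ∑ xs (f ∘ g)
∑-map g [] f = refl
∑-map g (x ∷ xs) f = cong (f (g x) +ℤ_) (∑-map g xs f)

*-distribˡ-∑ : (c : ℤ) (xs : List A) (f : A → ℤ) → c *ℤ ∑ xs f ≡ ∑ xs (λ x → c *ℤ f x)
*-distribˡ-∑ c [] f = ℤ.*-zeroʳ c
*-distribˡ-∑ c (x ∷ xs) f =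
  trans (ℤ.*-distribˡ-+ c (f x) _) (cong (c *ℤ f x +ℤ_) (*-distribˡ-∑ c xs f))

*-distribʳ-∑ : (c : ℤ) (xs : List A) (f : A → ℤ) → ∑ xs f *ℤ c ≡ ∑ xs (λ x → f x *ℤ c)
*-distribʳ-∑ c xs f = trans (ℤ.*-comm _ c)
  (trans (*-distribˡ-∑ c xs f) (∑-cong xs (λ x → ℤ.*-comm c (f x))))

∑-comm : (xs : List A) (ys : List B) (F : A → B → ℤ)
  → ∑ xs (λ x → ∑ ys (F x)) ≡ ∑ ys (λ y → ∑ xs (λ x → F x y))
∑-comm [] ys F = sym (∑-zero ys (λ _ → refl))
∑-comm (x ∷ xs) ys F =
  trans (cong (∑ ys (F x) +ℤ_) (∑-comm xs ys F)) (sym (∑-+ ys))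

∑-filter : {P : A → Set} (P? : ∀ x → Dec (P x)) (xs : List A) (f : A → ℤ)
  → ∑ (filter P? xs) f ≡ ∑ xs (λ x → [ P? x ]· f x)
∑-filter P? [] f = refl
∑-filter P? (x ∷ xs) f with P? x
... | yes _ = cong (f x +ℤ_) (∑-filter P? xs f)
... | no _ = trans (∑-filter P? xs f) (sym (ℤ.+-identityˡ _))

∣-∑ : {d : ℤ} {f : A → ℤ} (xs : List A) → (∀ x → d ∣ˢ f x) → d ∣ˢ ∑ xs f
∣-∑ [] _ = divides 0ℤ refl
∣-∑ (x ∷ xs) d∣f = ∣m∣n⇒∣m+n (d∣f x) (∣-∑ xs d∣f)

[]·-yes : (p : Dec P) → P → (v : ℤ) → [ p ]· v ≡ v
[]·-yes (yes _) _ v = refl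
[]·-yes (no ¬a) a v = ⊥-elim (¬a a)

[]·-no : (p : Dec P) → ¬ P → (v : ℤ) → [ p ]· v ≡ 0ℤ
[]·-no (yes a) ¬a v = ⊥-elim (¬a a)
[]·-no (no _) _ v = refl

[]·-cong : (p : Dec P) (q : Dec Q) → (P → Q) → (Q → P) → (v : ℤ) → [ p ]· v ≡ [ q ]· v
[]·-cong (yes _) (yes _) _ _ v = refl
[]·-cong (yes a) (no ¬b) P→Q _ v = ⊥-elim (¬b (P→Q a))
[]·-cong (no ¬a) (yes b) _ Q→P v = ⊥-elim (¬a (Q→P b))
[]·-cong (no _) (no _) _ _ v = refl

[]·-[]· : (p : Dec P) (q : Dec Q) (v : ℤ) → [ p ]· [ q ]· v ≡ [ p ×-dec q ]· v
[]·-[]· (yes _) (yes _) v = refl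
[]·-[]· (yes _) (no _) v = refl
[]·-[]· (no _) q v = refl

[]·-*ˡ : (p : Dec P) (u v : ℤ) → [ p ]· (u *ℤ v) ≡ u *ℤ [ p ]· v
[]·-*ˡ (yes _) u v = refl
[]·-*ˡ (no _) u v = sym (ℤ.*-zeroʳ u)

[p]·v≡[p]·1*v : (p : Dec P) (v : ℤ) → [ p ]· v ≡ [ p ]· 1ℤ *ℤ v
[p]·v≡[p]·1*v (yes _) v = sym (ℤ.*-identityˡ v)
[p]·v≡[p]·1*v (no _) v = refl

[]·-∑ : (p : Dec P) (xs : List A) (f : A → ℤ) → [ p ]· ∑ xs f ≡ ∑ xs (λ x → [ p ]· f x)
[]·-∑ (yes _) xs f = refl
[]·-∑ (no _) xs f = sym (∑-zero xs (λ _ → refl))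

module _ {P : A → Set} (p : ∀ x → Dec (P x)) where

  ∑-[]·-cong : {Q : A → Set} (q : ∀ x → Dec (Q x)) (xs : List A) {v : A → ℤ}
    → (∀ x → P x → Q x) → (∀ x → Q x → P x)
    → ∑ xs (λ x → [ p x ]· v x) ≡ ∑ xs (λ x → [ q x ]· v x)
  ∑-[]·-cong q xs P→Q Q→P = ∑-cong xs (λ x → []·-cong (p x) (q x) (P→Q x) (Q→P x) _)

  ∑-[]·-none : (xs : List A) {v : A → ℤ} → (∀ x → ¬ P x) → ∑ xs (λ x → [ p x ]· v x) ≡ 0ℤ
  ∑-[]·-none xs ¬P = ∑-zero xs (λ x → []·-no (p x) (¬P x) _)

∑ₛ : (Subset n → ℤ) → ℤ
∑ₛ {n} = ∑ (allSubsets n)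

∑ₛ-suc : (f : Subset (suc n) → ℤ)
  → ∑ₛ f ≡ ∑ₛ (λ S → f (outside ∷ S)) +ℤ ∑ₛ (λ S → f (inside ∷ S))
∑ₛ-suc {n} f = trans (∑-++ (map (outside ∷_) (allSubsets n)) _ f)
  (cong₂ _+ℤ_ (∑-map (outside ∷_) (allSubsets n) f) (∑-map (inside ∷_) (allSubsets n) f))

∣-∑ₛ⇒∣-term : {d : ℤ} (f : Subset n → ℤ) (S₀ : Subset n)
  → (∀ S → S ≢ S₀ → d ∣ˢ f S) → d ∣ˢ ∑ₛ f → d ∣ˢ f S₀
∣-∑ₛ⇒∣-term f [] _ d∣∑ = subst (_ ∣ˢ_) (ℤ.+-identityʳ (f [])) d∣∑
∣-∑ₛ⇒∣-term f (outside ∷ S₀) d∣others d∣∑ =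
  ∣-∑ₛ⇒∣-term (f ∘ (outside ∷_)) S₀ (λ S S≢S₀ → d∣others _ (S≢S₀ ∘ cong tail))
    (∣m+n∣n⇒∣m (subst (_ ∣ˢ_) (∑ₛ-suc f) d∣∑)
               (∣-∑ (allSubsets _) (λ S → d∣others (inside ∷ S) (λ ()))))
∣-∑ₛ⇒∣-term f (inside ∷ S₀) d∣others d∣∑ =
  ∣-∑ₛ⇒∣-term (f ∘ (inside ∷_)) S₀ (λ S S≢S₀ → d∣others _ (S≢S₀ ∘ cong tail))
    (∣m+n∣m⇒∣n (subst (_ ∣ˢ_) (∑ₛ-suc f) d∣∑)
               (∣-∑ (allSubsets _) (λ S → d∣others (outside ∷ S) (λ ()))))

Superset : ℕ → Subset n → Subset n → Set
Superset m A S = ∣ S ∣ ≡ m × A ⊆ S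

superset? : (m : ℕ) (A S : Subset n) → Dec (Superset m A S)
superset? m A S = (∣ S ∣ ≟ m) ×-dec (A ⊆? S)

ext-as-∑ₛ : (r : ℕ) (φ : Subset n → ℤ) (A : Subset n)
  → ext r φ A ≡ ∑ₛ (λ S → [ superset? r A S ]· φ S)
ext-as-∑ₛ {n} r φ A = ∑-filter (superset? r A) (allSubsets n) φ

Between : ℕ → Subset n → Subset n → Subset n → Set
Between m A R S = Superset m A S × S ⊆ R

between? : (m : ℕ) (A R S : Subset n) → Dec (Between m A R S)
between? m A R S = superset? m A S ×-dec (S ⊆? R)

#between : ℕ → Subset n → Subset n → ℤ
#between m A R = ∑ₛ (λ S → [ between? m A R S ]· 1ℤ)

#between-headed : Side → ℕ → Subset (suc n) → Subset (suc n) → ℤ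
#between-headed s m A R = ∑ₛ (λ S → [ between? m A R (s ∷ S) ]· 1ℤ)

module _ {n : ℕ} (m : ℕ) (A R : Subset (suc n)) where

  #between-∷ :
    #between m A R ≡ #between-headed outside m A R +ℤ #between-headed inside m A R
  #between-∷ = ∑ₛ-suc (λ S → [ between? m A R S ]· 1ℤ)

  #between-headed-cong : ∀ s m′ (A′ R′ : Subset n)
    → (∀ S → Between m A R (s ∷ S) → Between m′ A′ R′ S)
    → (∀ S → Between m′ A′ R′ S → Between m A R (s ∷ S))
    → #between-headed s m A R ≡ #between m′ A′ R′
  #between-headed-cong s m′ A′ R′ =
    ∑-[]·-cong (between? m A R ∘ (s ∷_)) (between? m′ A′ R′) (allSubsets n)

  #between-headed-none : ∀ s → (∀ S → ¬ Between m A R (s ∷ S))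
    → #between-headed s m A R ≡ 0ℤ
  #between-headed-none s = ∑-[]·-none (between? m A R ∘ (s ∷_)) (allSubsets n) {λ _ → 1ℤ}

module _ {n : ℕ} (A R : Subset n) where

  private
    headed-outside : ∀ m r → #between-headed outside m (outside ∷ A) (r ∷ R) ≡ #between m A R
    headed-outside m r = #between-headed-cong m (outside ∷ A) (r ∷ R) outside m A R
      (λ _ ((∣S∣≡m , A⊆S) , S⊆R) → (∣S∣≡m , drop-∷-⊆ A⊆S) , drop-∷-⊆ S⊆R)
      (λ _ ((∣S∣≡m , A⊆S) , S⊆R) → (∣S∣≡m , out⊆ A⊆S) , out⊆ S⊆R)

  #between-out-out : ∀ m → #between m (outside ∷ A) (outside ∷ R) ≡ #between m A R
  #between-out-out m = trans (#between-∷ m (outside ∷ A) (outside ∷ R))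
    (trans (cong₂ _+ℤ_ (headed-outside m outside)
                       (#between-headed-none m (outside ∷ A) (outside ∷ R) inside
                         (λ _ (_ , S⊆R) → ∉outside S⊆R)))
           (ℤ.+-identityʳ _))
    where
    ∉outside : ∀ {S : Subset n} → ¬ (inside ∷ S ⊆ outside ∷ R)
    ∉outside ⊆ with ⊆ here
    ... | ()

  #between-in-in : ∀ m → #between (suc m) (inside ∷ A) (inside ∷ R) ≡ #between m A R
  #between-in-in m = trans (#between-∷ (suc m) (inside ∷ A) (inside ∷ R))
    (trans (cong₂ _+ℤ_
             (#between-headed-none (suc m) (inside ∷ A) (inside ∷ R) outside
               (λ _ ((_ , A⊆S) , _) → ∉outside A⊆S))
             (#between-headed-cong (suc m) (inside ∷ A) (inside ∷ R) inside m A R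
               (λ _ ((∣S∣≡m , A⊆S) , S⊆R) → (suc-injective ∣S∣≡m , drop-∷-⊆ A⊆S) , drop-∷-⊆ S⊆R)
               (λ _ ((∣S∣≡m , A⊆S) , S⊆R) → (cong suc ∣S∣≡m , s⊆s A⊆S) , s⊆s S⊆R)))
           (ℤ.+-identityˡ _))
    where
    ∉outside : ∀ {S : Subset n} → ¬ (inside ∷ A ⊆ outside ∷ S)
    ∉outside ⊆ with ⊆ here
    ... | ()

  #between-out-in : ∀ m
    → #between (suc m) (outside ∷ A) (inside ∷ R) ≡ #between (suc m) A R +ℤ #between m A R
  #between-out-in m = trans (#between-∷ (suc m) (outside ∷ A) (inside ∷ R))
    (cong₂ _+ℤ_ (headed-outside (suc m) inside)
                (#between-headed-cong (suc m) (outside ∷ A) (inside ∷ R) inside m A R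
                  (λ _ ((∣S∣≡m , A⊆S) , S⊆R) → (suc-injective ∣S∣≡m , drop-∷-⊆ A⊆S) , drop-∷-⊆ S⊆R)
                  (λ _ ((∣S∣≡m , A⊆S) , S⊆R) → (cong suc ∣S∣≡m , out⊆ A⊆S) , s⊆s S⊆R)))

  #between-out-in-≤ : ∀ m → m ≤ ∣ A ∣
    → #between m (outside ∷ A) (inside ∷ R) ≡ #between m A R
  #between-out-in-≤ m m≤∣A∣ = trans (#between-∷ m (outside ∷ A) (inside ∷ R))
    (trans (cong₂ _+ℤ_ (headed-outside m inside)
                       (#between-headed-none m (outside ∷ A) (inside ∷ R) inside
                         (λ S ((∣S∣≡m , A⊆S) , _) → 1+n≰n (≤-trans (≤-reflexive ∣S∣≡m)
                            (≤-trans m≤∣A∣ (p⊆q⇒∣p∣≤∣q∣ (drop-∷-⊆ A⊆S)))))))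
           (ℤ.+-identityʳ _))

#between≡C : (A R : Subset n) (j : ℕ) → A ⊆ R
  → #between (∣ A ∣ + j) A R ≡ + ((∣ R ∣ ∸ ∣ A ∣) C j)
#between≡C [] [] zero _ = refl
#between≡C [] [] (suc j) _ = refl
#between≡C (outside ∷ A) (outside ∷ R) j A⊆R =
  trans (#between-out-out A R _) (#between≡C A R j (drop-∷-⊆ A⊆R))
#between≡C (inside ∷ A) (inside ∷ R) j A⊆R =
  trans (#between-in-in A R _) (#between≡C A R j (drop-∷-⊆ A⊆R))
#between≡C (inside ∷ A) (outside ∷ R) j A⊆R with A⊆R here
... | ()
#between≡C (outside ∷ A) (inside ∷ R) zero A⊆R =
  trans (#between-out-in-≤ A R _ (≤-reflexive (+-identityʳ _)))
        (#between≡C A R zero (drop-∷-⊆ A⊆R))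
#between≡C (outside ∷ A) (inside ∷ R) (suc j) A⊆R = begin
  #between (∣ A ∣ + suc j) (outside ∷ A) (inside ∷ R)
    ≡⟨ cong (λ m → #between m (outside ∷ A) (inside ∷ R)) (+-suc ∣ A ∣ j) ⟩
  #between (suc (∣ A ∣ + j)) (outside ∷ A) (inside ∷ R)
    ≡⟨ #between-out-in A R _ ⟩
  #between (suc (∣ A ∣ + j)) A R +ℤ #between (∣ A ∣ + j) A R
    ≡⟨ cong₂ _+ℤ_ (trans (cong (λ m → #between m A R) (sym (+-suc ∣ A ∣ j)))
                         (#between≡C A R (suc j) A⊆R′))
                  (#between≡C A R j A⊆R′) ⟩
  + (x C suc j) +ℤ + (x C j)
    ≡⟨ ℤ.pos-+ (x C suc j) (x C j) ⟨
  + (x C suc j + x C j)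
    ≡⟨ cong +_ (trans (+-comm (x C suc j) (x C j)) (nCk+nC[k+1]≡[n+1]C[k+1] x j)) ⟩
  + (suc x C suc j)
    ≡⟨ cong (λ y → + (y C suc j)) (+-∸-assoc 1 (p⊆q⇒∣p∣≤∣q∣ A⊆R′)) ⟨
  + ((suc ∣ R ∣ ∸ ∣ A ∣) C suc j) ∎
  where
  open ≡-Reasoning
  A⊆R′ = drop-∷-⊆ A⊆R
  x = ∣ R ∣ ∸ ∣ A ∣

∑ₛ-superset-superset : (k r : ℕ) (A R : Subset n) (v : ℤ) → ∣ A ∣ ≤ k
  → ∑ₛ (λ S → [ superset? k A S ]· [ superset? r S R ]· v)
    ≡ [ superset? r A R ]· (+ ((r ∸ ∣ A ∣) C (k ∸ ∣ A ∣)) *ℤ v)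
∑ₛ-superset-superset {n} k r A R v ∣A∣≤k with superset? r A R
... | yes (∣R∣≡r , A⊆R) = begin
  ∑ₛ (λ S → [ superset? k A S ]· [ superset? r S R ]· v)
    ≡⟨ ∑-cong (allSubsets n) (λ S → trans ([]·-[]· (superset? k A S) (superset? r S R) v)
         ([]·-cong (superset? k A S ×-dec superset? r S R) (between? k A R S)
           (λ (k-sup , _ , S⊆R) → k-sup , S⊆R) (λ (k-sup , S⊆R) → k-sup , ∣R∣≡r , S⊆R) v)) ⟩
  ∑ₛ (λ S → [ between? k A R S ]· v)
    ≡⟨ ∑-cong (allSubsets n) (λ S → [p]·v≡[p]·1*v (between? k A R S) v) ⟩
  ∑ₛ (λ S → [ between? k A R S ]· 1ℤ *ℤ v)
    ≡⟨ *-distribʳ-∑ v (allSubsets n) _ ⟨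
  #between k A R *ℤ v
    ≡⟨ cong (λ m → #between m A R *ℤ v) (m+[n∸m]≡n ∣A∣≤k) ⟨
  #between (∣ A ∣ + (k ∸ ∣ A ∣)) A R *ℤ v
    ≡⟨ cong (_*ℤ v) (#between≡C A R (k ∸ ∣ A ∣) A⊆R) ⟩
  + ((∣ R ∣ ∸ ∣ A ∣) C (k ∸ ∣ A ∣)) *ℤ v
    ≡⟨ cong (λ m → + ((m ∸ ∣ A ∣) C (k ∸ ∣ A ∣)) *ℤ v) ∣R∣≡r ⟩
  + ((r ∸ ∣ A ∣) C (k ∸ ∣ A ∣)) *ℤ v ∎
  where open ≡-Reasoning
... | no ¬r-sup = ∑-zero (allSubsets n) (λ S →
  trans ([]·-[]· (superset? k A S) (superset? r S R) v)
        ([]·-no _ (λ ((_ , A⊆S) , ∣R∣≡r , S⊆R) → ¬r-sup (∣R∣≡r , λ x∈A → S⊆R (A⊆S x∈A))) v))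

ext-ext : (k r : ℕ) (φ : Subset n → ℤ) (A : Subset n) → ∣ A ∣ ≤ k
  → ext k (ext r φ) A ≡ + ((r ∸ ∣ A ∣) C (k ∸ ∣ A ∣)) *ℤ ext r φ A
ext-ext {n} k r φ A ∣A∣≤k = begin
  ext k (ext r φ) A
    ≡⟨ ext-as-∑ₛ k (ext r φ) A ⟩
  ∑ₛ (λ S → [ superset? k A S ]· ext r φ S)
    ≡⟨ ∑-cong (allSubsets n) (λ S → trans (cong ([ superset? k A S ]·_) (ext-as-∑ₛ r φ S))
                                          ([]·-∑ (superset? k A S) (allSubsets n) _)) ⟩
  ∑ₛ (λ S → ∑ₛ (λ R → [ superset? k A S ]· [ superset? r S R ]· φ R))
    ≡⟨ ∑-comm (allSubsets n) (allSubsets n) _ ⟩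
  ∑ₛ (λ R → ∑ₛ (λ S → [ superset? k A S ]· [ superset? r S R ]· φ R))
    ≡⟨ ∑-cong (allSubsets n) (λ R → ∑ₛ-superset-superset k r A R (φ R) ∣A∣≤k) ⟩
  ∑ₛ (λ R → [ superset? r A R ]· (c *ℤ φ R))
    ≡⟨ ∑-cong (allSubsets n) (λ R → []·-*ˡ (superset? r A R) c (φ R)) ⟩
  ∑ₛ (λ R → c *ℤ [ superset? r A R ]· φ R)
    ≡⟨ *-distribˡ-∑ c (allSubsets n) _ ⟨
  c *ℤ ∑ₛ (λ R → [ superset? r A R ]· φ R)
    ≡⟨ cong (c *ℤ_) (ext-as-∑ₛ r φ A) ⟨
  c *ℤ ext r φ A ∎
  where
  open ≡-Reasoning
  c = + ((r ∸ ∣ A ∣) C (k ∸ ∣ A ∣))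

elements : Subset n → List (Fin n)
elements [] = []
elements (outside ∷ p) = map Fin.suc (elements p)
elements (inside ∷ p) = Fin.zero ∷ map Fin.suc (elements p)

length-elements : (p : Subset n) → length (elements p) ≡ ∣ p ∣
length-elements [] = refl
length-elements (outside ∷ p) = trans (length-map Fin.suc (elements p)) (length-elements p)
length-elements (inside ∷ p) =
  cong suc (trans (length-map Fin.suc (elements p)) (length-elements p))

All-elements⁺ : {P : Fin n → Set} (p : Subset n) → (∀ {x} → x ∈ p → P x) → All P (elements p)
All-elements⁺ [] _ = []
All-elements⁺ (outside ∷ p) P[p] = map⁺ (All-elements⁺ p (P[p] ∘ there))
All-elements⁺ (inside ∷ p) P[p] = P[p] here ∷ map⁺ (All-elements⁺ p (P[p] ∘ there))

All-elements⁻ : {P : Fin n → Set} (p : Subset n) → All P (elements p) → ∀ {x} → x ∈ p → P x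
All-elements⁻ (inside ∷ p) (Px ∷ _) here = Px
All-elements⁻ (inside ∷ p) (_ ∷ P[p]) (there x∈p) = All-elements⁻ p (map⁻ P[p]) x∈p
All-elements⁻ (outside ∷ p) P[p] (there x∈p) = All-elements⁻ p (map⁻ P[p]) x∈p

x∈p─q⇒x∉q : {x : Fin n} (p q : Subset n) → x ∈ p ─ q → x ∉ q
x∈p─q⇒x∉q (_ ∷ p) (_ ∷ q) (there x∈p─q) (there x∈q) = x∈p─q⇒x∉q p q x∈p─q x∈q

∣p─q∣+∣q∣≡∣p∣ : (p q : Subset n) → q ⊆ p → ∣ p ─ q ∣ + ∣ q ∣ ≡ ∣ p ∣
∣p─q∣+∣q∣≡∣p∣ [] [] _ = refl
∣p─q∣+∣q∣≡∣p∣ (outside ∷ p) (outside ∷ q) q⊆p = ∣p─q∣+∣q∣≡∣p∣ p q (drop-∷-⊆ q⊆p)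
∣p─q∣+∣q∣≡∣p∣ (inside ∷ p) (outside ∷ q) q⊆p = cong suc (∣p─q∣+∣q∣≡∣p∣ p q (drop-∷-⊆ q⊆p))
∣p─q∣+∣q∣≡∣p∣ (inside ∷ p) (inside ∷ q) q⊆p =
  trans (+-suc ∣ p ─ q ∣ ∣ q ∣) (cong suc (∣p─q∣+∣q∣≡∣p∣ p q (drop-∷-⊆ q⊆p)))
∣p─q∣+∣q∣≡∣p∣ (outside ∷ p) (inside ∷ q) q⊆p with q⊆p here
... | ()

p⊆q∧∣p∣≡∣q∣⇒p≡q : {p q : Subset n} → p ⊆ q → ∣ p ∣ ≡ ∣ q ∣ → p ≡ q
p⊆q∧∣p∣≡∣q∣⇒p≡q {p = []} {[]} _ _ = refl
p⊆q∧∣p∣≡∣q∣⇒p≡q {p = outside ∷ p} {outside ∷ q} p⊆q ∣p∣≡∣q∣ =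
  cong (outside ∷_) (p⊆q∧∣p∣≡∣q∣⇒p≡q (drop-∷-⊆ p⊆q) ∣p∣≡∣q∣)
p⊆q∧∣p∣≡∣q∣⇒p≡q {p = inside ∷ p} {inside ∷ q} p⊆q ∣p∣≡∣q∣ =
  cong (inside ∷_) (p⊆q∧∣p∣≡∣q∣⇒p≡q (drop-∷-⊆ p⊆q) (suc-injective ∣p∣≡∣q∣))
p⊆q∧∣p∣≡∣q∣⇒p≡q {p = outside ∷ p} {inside ∷ q} p⊆q ∣p∣≡∣q∣ =
  ⊥-elim (1+n≰n (≤-trans (≤-reflexive (sym ∣p∣≡∣q∣)) (p⊆q⇒∣p∣≤∣q∣ (drop-∷-⊆ p⊆q))))
p⊆q∧∣p∣≡∣q∣⇒p≡q {p = inside ∷ p} {outside ∷ q} p⊆q _ with p⊆q here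
... | ()

∣p∪q∣≤∣p∣+∣q∣ : (p q : Subset n) → ∣ p ∪ q ∣ ≤ ∣ p ∣ + ∣ q ∣
∣p∪q∣≤∣p∣+∣q∣ [] [] = z≤n
∣p∪q∣≤∣p∣+∣q∣ (outside ∷ p) (outside ∷ q) = ∣p∪q∣≤∣p∣+∣q∣ p q
∣p∪q∣≤∣p∣+∣q∣ (outside ∷ p) (inside ∷ q) =
  ≤-trans (s≤s (∣p∪q∣≤∣p∣+∣q∣ p q)) (≤-reflexive (sym (+-suc ∣ p ∣ ∣ q ∣)))
∣p∪q∣≤∣p∣+∣q∣ (inside ∷ p) (s ∷ q) =
  s≤s (≤-trans (∣p∪q∣≤∣p∣+∣q∣ p q) (+-monoʳ-≤ ∣ p ∣ (∣p∣≤∣x∷p∣ s q)))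

p⊆q∧x∈q⇒p∪⁅x⁆⊆q : {p q : Subset n} {x : Fin n} → p ⊆ q → x ∈ q → p ∪ ⁅ x ⁆ ⊆ q
p⊆q∧x∈q⇒p∪⁅x⁆⊆q {p = p} {x = x} p⊆q x∈q y∈p∪⁅x⁆ with x∈p∪q⁻ p ⁅ x ⁆ y∈p∪⁅x⁆
... | inj₁ y∈p = p⊆q y∈p
... | inj₂ y∈⁅x⁆ = subst (_∈ _) (sym (x∈⁅y⁆⇒x≡y x y∈⁅x⁆)) x∈q

∣p∪⁅x⁆∣≤1+∣p∣ : (p : Subset n) (x : Fin n) → ∣ p ∪ ⁅ x ⁆ ∣ ≤ suc ∣ p ∣
∣p∪⁅x⁆∣≤1+∣p∣ p x =
  ≤-trans (∣p∪q∣≤∣p∣+∣q∣ p ⁅ x ⁆)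
          (≤-reflexive (trans (cong (λ m → ∣ p ∣ + m) (∣⁅x⁆∣≡1 x)) (+-comm ∣ p ∣ 1)))

p⊆q∧avoids[q─r]⇒p⊆r : {p q r : Subset n} → p ⊆ q → All (_∉ p) (elements (q ─ r)) → p ⊆ r
p⊆q∧avoids[q─r]⇒p⊆r {q = q} {r} p⊆q avoids {x} x∈p with x ∈? r
... | yes x∈r = x∈r
... | no x∉r = ⊥-elim (All-elements⁻ (q ─ r) avoids (x∈p∧x∉q⇒x∈p─q (p⊆q x∈p) x∉r) x∈p)

module AvoidingSums {n : ℕ} (k : ℕ) (ψ : Subset n → ℤ) where

  Avoiding : Subset n → List (Fin n) → Subset n → Set
  Avoiding A xs S = Superset k A S × All (_∉ S) xs

  avoiding? : (A : Subset n) (xs : List (Fin n)) (S : Subset n) → Dec (Avoiding A xs S)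
  avoiding? A xs S = superset? k A S ×-dec all? (λ x → ¬? (x ∈? S)) xs

  avoidingSum : Subset n → List (Fin n) → ℤ
  avoidingSum A xs = ∑ₛ (λ S → [ avoiding? A xs S ]· ψ S)

  avoidingSum-[] : (A : Subset n) → avoidingSum A [] ≡ ext k ψ A
  avoidingSum-[] A = trans
    (∑-[]·-cong (avoiding? A []) (superset? k A) (allSubsets n)
       (λ _ → proj₁) (λ _ k-sup → k-sup , []))
    (sym (ext-as-∑ₛ k ψ A))

  avoidingSum-∷ : (A : Subset n) (x : Fin n) (xs : List (Fin n))
    → avoidingSum A xs ≡ avoidingSum A (x ∷ xs) +ℤ avoidingSum (A ∪ ⁅ x ⁆) xs
  avoidingSum-∷ A x xs =
    trans (∑-cong (allSubsets n) (λ S → split S (x ∈? S))) (∑-+ (allSubsets n))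
    where
    split : ∀ S → Dec (x ∈ S) → [ avoiding? A xs S ]· ψ S
      ≡ [ avoiding? A (x ∷ xs) S ]· ψ S +ℤ [ avoiding? (A ∪ ⁅ x ⁆) xs S ]· ψ S
    split S (yes x∈S) = begin
      [ avoiding? A xs S ]· ψ S
        ≡⟨ []·-cong (avoiding? A xs S) (avoiding? (A ∪ ⁅ x ⁆) xs S)
             (λ ((∣S∣≡k , A⊆S) , avoids) → (∣S∣≡k , p⊆q∧x∈q⇒p∪⁅x⁆⊆q A⊆S x∈S) , avoids)
             (λ ((∣S∣≡k , A∪x⊆S) , avoids) → (∣S∣≡k , λ y∈A → A∪x⊆S (p⊆p∪q ⁅ x ⁆ y∈A)) , avoids)
             (ψ S) ⟩
      [ avoiding? (A ∪ ⁅ x ⁆) xs S ]· ψ S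
        ≡⟨ ℤ.+-identityˡ _ ⟨
      0ℤ +ℤ [ avoiding? (A ∪ ⁅ x ⁆) xs S ]· ψ S
        ≡⟨ cong (_+ℤ [ avoiding? (A ∪ ⁅ x ⁆) xs S ]· ψ S)
             ([]·-no (avoiding? A (x ∷ xs) S) (λ { (_ , x∉S ∷ _) → x∉S x∈S }) (ψ S)) ⟨
      [ avoiding? A (x ∷ xs) S ]· ψ S +ℤ [ avoiding? (A ∪ ⁅ x ⁆) xs S ]· ψ S ∎
      where open ≡-Reasoning
    split S (no x∉S) = begin
      [ avoiding? A xs S ]· ψ S
        ≡⟨ []·-cong (avoiding? A xs S) (avoiding? A (x ∷ xs) S)
             (λ (k-sup , avoids) → k-sup , x∉S ∷ avoids)
             (λ { (k-sup , _ ∷ avoids) → k-sup , avoids }) (ψ S) ⟩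
      [ avoiding? A (x ∷ xs) S ]· ψ S
        ≡⟨ ℤ.+-identityʳ _ ⟨
      [ avoiding? A (x ∷ xs) S ]· ψ S +ℤ 0ℤ
        ≡⟨ cong ([ avoiding? A (x ∷ xs) S ]· ψ S +ℤ_)
             ([]·-no (avoiding? (A ∪ ⁅ x ⁆) xs S)
               (λ ((_ , A∪x⊆S) , _) → x∉S (A∪x⊆S (q⊆p∪q A ⁅ x ⁆ (x∈⁅x⁆ x)))) (ψ S)) ⟨
      [ avoiding? A (x ∷ xs) S ]· ψ S +ℤ [ avoiding? (A ∪ ⁅ x ⁆) xs S ]· ψ S ∎
      where open ≡-Reasoning

  ∣-avoidingSum : {d : ℤ} {m : ℕ} → (∀ A → ∣ A ∣ ≤ m → d ∣ˢ ext k ψ A)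
    → ∀ xs A → ∣ A ∣ + length xs ≤ m → d ∣ˢ avoidingSum A xs
  ∣-avoidingSum d∣ext [] A ∣A∣+0≤m = subst (_ ∣ˢ_) (sym (avoidingSum-[] A))
    (d∣ext A (≤-trans (≤-reflexive (sym (+-identityʳ _))) ∣A∣+0≤m))
  ∣-avoidingSum d∣ext (x ∷ xs) A ≤m =
    ∣m+n∣n⇒∣m (subst (_ ∣ˢ_) (avoidingSum-∷ A x xs) (∣-avoidingSum d∣ext xs A ∣A∣+∣xs∣≤m))
              (∣-avoidingSum d∣ext xs (A ∪ ⁅ x ⁆) ∣A∪x∣+∣xs∣≤m)
    where
    ∣A∣+∣xs∣≤m : ∣ A ∣ + length xs ≤ _
    ∣A∣+∣xs∣≤m = ≤-trans (+-monoʳ-≤ ∣ A ∣ (n≤1+n _)) ≤m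
    ∣A∪x∣+∣xs∣≤m : ∣ A ∪ ⁅ x ⁆ ∣ + length xs ≤ _
    ∣A∪x∣+∣xs∣≤m = ≤-trans (+-monoˡ-≤ (length xs) (∣p∪⁅x⁆∣≤1+∣p∣ A x))
                           (≤-trans (≤-reflexive (sym (+-suc ∣ A ∣ (length xs)))) ≤m)

module _ {n : ℕ} (k′ : ℕ) (ψ : Subset n → ℤ) {d : ℤ}
  (d∣ext : ∀ A → ∣ A ∣ ≤ k′ → d ∣ˢ ext (suc k′) ψ A)
  (K : Subset n) (∣K∣≤2k-1 : ∣ K ∣ ≤ k′ + suc k′)
  (bad⊆K : ∀ S → ∣ S ∣ ≡ suc k′ → ¬ d ∣ˢ ψ S → S ⊆ K) where

  open AvoidingSums (suc k′) ψ

  ∣-on-k-subsets-of-K : ∀ S₀ → S₀ ⊆ K → ∣ S₀ ∣ ≡ suc k′ → d ∣ˢ ψ S₀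
  ∣-on-k-subsets-of-K S₀ S₀⊆K ∣S₀∣≡k =
    subst (d ∣ˢ_) ([]·-yes (avoiding? ∅ T S₀) ((∣S₀∣≡k , ⊥⊆) , S₀-avoids-T) (ψ S₀))
      (∣-∑ₛ⇒∣-term (λ S → [ avoiding? ∅ T S ]· ψ S) S₀ others
        (∣-avoidingSum d∣ext T ∅ (≤-trans (≤-reflexive (cong (_+ length T) (∣⊥∣≡0 n))) ∣T∣≤k′)))
    where
    T = elements (K ─ S₀)

    ∣T∣≤k′ : length T ≤ k′
    ∣T∣≤k′ = +-cancelʳ-≤ (suc k′) (length T) k′ (≤-trans (≤-reflexive (begin
        length T + suc k′    ≡⟨ cong₂ _+_ (length-elements (K ─ S₀)) (sym ∣S₀∣≡k) ⟩
        ∣ K ─ S₀ ∣ + ∣ S₀ ∣  ≡⟨ ∣p─q∣+∣q∣≡∣p∣ K S₀ S₀⊆K ⟩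
        ∣ K ∣                 ∎)) ∣K∣≤2k-1)
      where open ≡-Reasoning

    S₀-avoids-T : All (_∉ S₀) T
    S₀-avoids-T = All-elements⁺ (K ─ S₀) (x∈p─q⇒x∉q K S₀)

    others : ∀ S → S ≢ S₀ → d ∣ˢ [ avoiding? ∅ T S ]· ψ S
    others S S≢S₀ with avoiding? ∅ T S | d ∣ˢ? ψ S
    ... | no _ | _ = divides 0ℤ refl
    ... | yes _ | yes d∣ψS = d∣ψS
    ... | yes ((∣S∣≡k , _) , S-avoids-T) | no d∤ψS = ⊥-elim (S≢S₀ (p⊆q∧∣p∣≡∣q∣⇒p≡q
            (p⊆q∧avoids[q─r]⇒p⊆r (bad⊆K S ∣S∣≡k d∤ψS) S-avoids-T) (trans ∣S∣≡k (sym ∣S₀∣≡k))))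

  ∣-on-k-sets : ∀ S → ∣ S ∣ ≡ suc k′ → d ∣ˢ ψ S
  ∣-on-k-sets S ∣S∣≡k with d ∣ˢ? ψ S
  ... | yes d∣ψS = d∣ψS
  ... | no d∤ψS = ∣-on-k-subsets-of-K S (bad⊆K S ∣S∣≡k d∤ψS) ∣S∣≡k

∣-ext-ext : (k r : ℕ) (b : ℕ → ℕ) (φ : Subset n → ℤ) (A : Subset n) → ∣ A ∣ ≤ k
  → b k ∣ ((r ∸ ∣ A ∣) C (k ∸ ∣ A ∣)) * b (∣ A ∣) → + b (∣ A ∣) ∣ℤ ext r φ A
  → + b k ∣ˢ ext k (ext r φ) A
∣-ext-ext k r b φ A ∣A∣≤k bₖ∣C*b b∣ext = subst (+ b k ∣ˢ_) (sym (ext-ext k r φ A ∣A∣≤k))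
  (∣-trans (∣ᵤ⇒∣ {+ b k} {+ c *ℤ + b ∣ A ∣} (subst (+ b k ∣ℤ_) (ℤ.pos-* c (b ∣ A ∣)) bₖ∣C*b))
           (*-monoʳ-∣ (+ c) (∣ᵤ⇒∣ b∣ext)))
  where c = (r ∸ ∣ A ∣) C (k ∸ ∣ A ∣)

lemma9p5 : (k r : ℕ) → 1 ≤ k → k < r → (b : ℕ → ℕ)
    → (∀ i → i ≤ k → b k ∣ ((r ∸ i) C (k ∸ i)) * b i)
    → (n : ℕ) (φ : Subset n → ℤ)
    → Divisible r φ b (k ∸ 1)
    → Σ (Subset n) (λ K → (∣ K ∣ ≡ (k + k) ∸ 1)
    × (∀ S → ∣ S ∣ ≡ k → ¬ ((+ b k) ∣ℤ ext r φ S) → S ⊆ K))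
    → Divisible r φ b k
lemma9p5 (suc k′) r _ _ b bₖ∣C*b n φ divisible-below (K , ∣K∣≡2k-1 , bad⊆K) S ∣S∣≤k
  with m≤n⇒m<n∨m≡n ∣S∣≤k
... | inj₁ ∣S∣<k = divisible-below S (≤-pred ∣S∣<k)
... | inj₂ ∣S∣≡k = subst (λ m → + b m ∣ℤ ext r φ S) (sym ∣S∣≡k)
        (∣⇒∣ᵤ (∣-on-k-sets k′ (ext r φ) bₖ∣ext-ext K (≤-reflexive ∣K∣≡2k-1)
                 (λ S ∣S∣≡k bₖ∤ → bad⊆K S ∣S∣≡k (bₖ∤ ∘ ∣ᵤ⇒∣)) S ∣S∣≡k))
  where
  bₖ∣ext-ext : ∀ A → ∣ A ∣ ≤ k′ → + b (suc k′) ∣ˢ ext (suc k′) (ext r φ) A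
  bₖ∣ext-ext A ∣A∣≤k′ =
    ∣-ext-ext (suc k′) r b φ A ∣A∣≤k (bₖ∣C*b ∣ A ∣ ∣A∣≤k) (divisible-below A ∣A∣≤k′)
    where ∣A∣≤k = ≤-trans ∣A∣≤k′ (n≤1+n k′)
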